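{- Let $S=\{x_i\}_{i=1}^\infty$ and $T=\{y_i\}_{i=1}^\infty$ be strictly increasing sequences of positive integers such that $y_1=m$, $m$ divides every $y_i$, and $x_i\geq y_i$ for all $i$. Then for all $n\geq 1$, \[ \rho(T;mn)\geq \rho(S;mn). \]
   Context: For a set $R$ of positive integers, $\rho(R;n)$ denotes the number of partitions of $n$ all of whose parts lie in $R$ (parts may repeat). -}

module Defs where

open import Data.Nat using (ℕ; _≥_)
open import Data.List using (List)
open import Data.Nat.ListAction using (sum)
open import Data.List.Relation.Unary.All using (All)
open import Data.List.Relation.Unary.Linked using (Linked)
open import Data.Fin using (Fin)
open import Data.Product using (∃)
open import Function.Bundles using (_↔_)
open import Relation.Binary.PropositionalEquality using (_≡_)

-- The set R = { x i | i ∈ ℕ } of values of a sequence x (indexed from 0).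
InSeq : (ℕ → ℕ) → ℕ → Set
InSeq x p = ∃ λ i → x i ≡ p

record Partition (x : ℕ → ℕ) (n : ℕ) : Set where
  constructor mkPartition
  field
    parts  : List ℕ
    sorted : Linked _≥_ parts
    inR    : All (InSeq x) parts
    total  : sum parts ≡ n

-- ρ(R;n) = c : the partitions of n with parts in R are in bijection with Fin c.
HasRho : (ℕ → ℕ) → ℕ → ℕ → Set
HasRho x n c = Fin c ↔ Partition x n

-- Idea: send a partition of N = m n with parts x_{i₁} ≥ … ≥ x_{iₖ} to the partition
-- with parts y_{i₁} ≥ … ≥ y_{iₖ}, padded with (N − Σ y_{iⱼ}) / m parts equal to y₁ = m.
-- The padding is a whole number because m divides N and every y_i, and it is
-- non-negative because y_i ≤ x_i. The map is injective: the padding parts are the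
-- smallest y-parts, and the x-sum N tells how many of them came from the original.
module Submission where

open import Defs
open import Data.Nat using (ℕ; suc; _*_; _≤_; _<_; _≥_)
open import Data.Nat.Divisibility using (_∣_)
open import Relation.Binary.PropositionalEquality using (_≡_)

open import Data.Nat using (zero; _+_; _∸_; _≤′_; ≤′-refl; ≤′-step; z≤n)
open import Data.Nat.Properties
open import Data.Nat.Divisibility using (quotient; ∣m∣n⇒∣m+n; ∣m+n∣m⇒∣n; _∣0; m∣m*n)
open import Data.Nat.ListAction using (sum)
open import Data.Nat.ListAction.Properties using (sum-++)
open import Data.List using (List; []; _∷_; map; replicate; _++_)
open import Data.List.Properties using (map-++; map-replicate; ∷-injective; map-injective)
open import Data.List.Relation.Unary.All as All using (All; []; _∷_)
open import Data.List.Relation.Unary.Linked as Linked using (Linked; []; [-]; _∷_)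
open import Data.Fin using (Fin)
open import Data.Fin.Properties using (injective⇒≤)
open import Data.Product using (_,_)
open import Data.Empty using (⊥-elim)
open import Function.Base using (_∘_)
open import Function.Bundles using (_↔_; _↣_; mk↣; Injection)
open import Function.Definitions using (Injective)
open import Function.Properties.Inverse using (↔-sym; ↔⇒↣)
open import Function.Construct.Composition using (_↣-∘_)
open import Relation.Binary.PropositionalEquality using (refl; sym; trans; cong; subst; module ≡-Reasoning)

module StrictlyIncreasing (f : ℕ → ℕ) (f-inc : ∀ i → f i < f (suc i)) where

  mono-≤′ : ∀ {i j} → i ≤′ j → f i ≤ f j
  mono-≤′ ≤′-refl        = ≤-refl
  mono-≤′ (≤′-step i≤′j) = ≤-trans (mono-≤′ i≤′j) (<⇒≤ (f-inc _))

  mono-≤ : ∀ {i j} → i ≤ j → f i ≤ f j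
  mono-≤ = mono-≤′ ∘ ≤⇒≤′

  mono-< : ∀ {i j} → i < j → f i < f j
  mono-< {i} i<j = <-≤-trans (f-inc i) (mono-≤ i<j)

  cancel-≤ : ∀ {i j} → f i ≤ f j → i ≤ j
  cancel-≤ fi≤fj = ≮⇒≥ (λ j<i → <⇒≱ (mono-< j<i) fi≤fj)

  injective : Injective _≡_ _≡_ f
  injective e = ≤-antisym (cancel-≤ (≤-reflexive e)) (cancel-≤ (≤-reflexive (sym e)))

  InSeq-irrelevant : ∀ {v} (p q : InSeq f v) → p ≡ q
  InSeq-irrelevant (i , e) (j , e') with injective (trans e (sym e'))
  ... | refl = cong (i ,_) (≡-irrelevant e e')

  Partition-≡ : ∀ {N} {p q : Partition f N} → Partition.parts p ≡ Partition.parts q → p ≡ q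
  Partition-≡ {p = mkPartition L s a t} {mkPartition .L s' a' t'} refl
    with Linked.irrelevant ≤-irrelevant s s' | All.irrelevant InSeq-irrelevant a a' | ≡-irrelevant t t'
  ... | refl | refl | refl = refl

  indices : ∀ {L} → All (InSeq f) L → List ℕ
  indices []            = []
  indices ((i , _) ∷ a) = i ∷ indices a

  map-indices : ∀ {L} (a : All (InSeq f) L) → map f (indices a) ≡ L
  map-indices []               = refl
  map-indices ((i , refl) ∷ a) = cong (f i ∷_) (map-indices a)

  indices-sorted : ∀ {L} → Linked _≥_ L → (a : All (InSeq f) L) → Linked _≥_ (indices a)
  indices-sorted []      []      = []
  indices-sorted [-]     (_ ∷ []) = [-]
  indices-sorted (r ∷ l) ((i , refl) ∷ (j , refl) ∷ a) =
    cancel-≤ r ∷ indices-sorted l ((j , refl) ∷ a)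

  map-sorted : ∀ {I} → Linked _≥_ I → Linked _≥_ (map f I)
  map-sorted []      = []
  map-sorted [-]     = [-]
  map-sorted (r ∷ l) = mono-≤ r ∷ map-sorted l

  map-InSeq : ∀ I → All (InSeq f) (map f I)
  map-InSeq []      = []
  map-InSeq (i ∷ I) = (i , refl) ∷ map-InSeq I

replicate-0-sorted : ∀ k → Linked _≥_ (replicate k 0)
replicate-0-sorted zero          = []
replicate-0-sorted (suc zero)    = [-]
replicate-0-sorted (suc (suc k)) = z≤n ∷ replicate-0-sorted (suc k)

++-replicate-0-sorted : ∀ {I} k → Linked _≥_ I → Linked _≥_ (I ++ replicate k 0)
++-replicate-0-sorted k       []      = replicate-0-sorted k
++-replicate-0-sorted zero    [-]     = [-]
++-replicate-0-sorted (suc k) [-]     = z≤n ∷ replicate-0-sorted (suc k)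
++-replicate-0-sorted k       (r ∷ l) = r ∷ ++-replicate-0-sorted k l

sum-replicate : ∀ k c → sum (replicate k c) ≡ k * c
sum-replicate zero    c = refl
sum-replicate (suc k) c = cong (c +_) (sum-replicate k c)

sum-map-mono-≤ : ∀ {A : Set} {f g : A → ℕ} → (∀ a → f a ≤ g a) →
  ∀ I → sum (map f I) ≤ sum (map g I)
sum-map-mono-≤ f≤g []      = z≤n
sum-map-mono-≤ f≤g (i ∷ I) = +-mono-≤ (f≤g i) (sum-map-mono-≤ f≤g I)

∣-sum-map : ∀ {A : Set} {f : A → ℕ} {d} → (∀ a → d ∣ f a) → ∀ I → d ∣ sum (map f I)
∣-sum-map d∣f []      = _ ∣0
∣-sum-map d∣f (i ∷ I) = ∣m∣n⇒∣m+n (d∣f i) (∣-sum-map d∣f I)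

-- The weight f z > 0 forbids moving a copy of z between the list and its padding.
++-replicate-cancel : ∀ {A : Set} (f : A → ℕ) {z} → 0 < f z → ∀ I I' k k' →
  I ++ replicate k z ≡ I' ++ replicate k' z → sum (map f I) ≡ sum (map f I') → I ≡ I'
++-replicate-cancel f fz>0 []      []        k       k'       e s = refl
++-replicate-cancel f fz>0 []      (i' ∷ I') (suc k) k'       e s with ∷-injective e
... | refl , _ = ⊥-elim (<⇒≢ fz>0 (sym (m+n≡0⇒m≡0 _ (sym s))))
++-replicate-cancel f fz>0 (i ∷ I) []        k       (suc k') e s with ∷-injective e
... | refl , _ = ⊥-elim (<⇒≢ fz>0 (sym (m+n≡0⇒m≡0 _ s)))
++-replicate-cancel f fz>0 (i ∷ I) (i' ∷ I') k       k'       e s with ∷-injective e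
... | refl , e' = cong (i ∷_) (++-replicate-cancel f fz>0 I I' k k' e' (+-cancelˡ-≡ (f i) _ _ s))

module Padding (x y : ℕ → ℕ) (m : ℕ)
  (x₀>0 : 0 < x 0) (x-inc : ∀ i → x i < x (suc i)) (y-inc : ∀ i → y i < y (suc i))
  (y₀≡m : y 0 ≡ m) (m∣y : ∀ i → m ∣ y i) (x≥y : ∀ i → x i ≥ y i)
  (N : ℕ) (m∣N : m ∣ N) where

  module X = StrictlyIncreasing x x-inc
  module Y = StrictlyIncreasing y y-inc

  module _ (p : Partition x N) where
    open Partition p

    I : List ℕ
    I = X.indices inR

    x-sum : sum (map x I) ≡ N
    x-sum = trans (cong sum (X.map-indices inR)) total

    y-sum : ℕ
    y-sum = sum (map y I)

    y-sum≤N : y-sum ≤ N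
    y-sum≤N = subst (y-sum ≤_) x-sum (sum-map-mono-≤ x≥y I)

    m∣slack : m ∣ N ∸ y-sum
    m∣slack = ∣m+n∣m⇒∣n (subst (m ∣_) (sym (m+[n∸m]≡n y-sum≤N)) m∣N) (∣-sum-map m∣y I)

    padding : ℕ
    padding = quotient m∣slack

    padded : List ℕ
    padded = I ++ replicate padding 0

    padded-y-sum : sum (map y padded) ≡ N
    padded-y-sum = begin
      sum (map y (I ++ replicate padding 0))          ≡⟨ cong sum (map-++ y I _) ⟩
      sum (map y I ++ map y (replicate padding 0))    ≡⟨ sum-++ (map y I) _ ⟩
      y-sum + sum (map y (replicate padding 0))       ≡⟨ cong (λ L → y-sum + sum L) (map-replicate y padding 0) ⟩
      y-sum + sum (replicate padding (y 0))           ≡⟨ cong (y-sum +_) (sum-replicate padding (y 0)) ⟩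
      y-sum + padding * y 0                           ≡⟨ cong (λ c → y-sum + padding * c) y₀≡m ⟩
      y-sum + padding * m                             ≡⟨ cong (y-sum +_) (sym (_∣_.equality m∣slack)) ⟩
      y-sum + (N ∸ y-sum)                             ≡⟨ m+[n∸m]≡n y-sum≤N ⟩
      N                                               ∎
      where open ≡-Reasoning

    pad : Partition y N
    pad = mkPartition (map y padded)
      (Y.map-sorted (++-replicate-0-sorted padding (X.indices-sorted sorted inR)))
      (Y.map-InSeq padded) padded-y-sum

  pad-injective : Injective _≡_ _≡_ pad
  pad-injective {p} {p'} e = X.Partition-≡ (begin
    Partition.parts p                  ≡⟨ sym (X.map-indices (Partition.inR p)) ⟩
    map x (I p)                        ≡⟨ cong (map x) I≡I' ⟩
    map x (I p')                       ≡⟨ X.map-indices (Partition.inR p') ⟩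
    Partition.parts p'                 ∎)
    where
    open ≡-Reasoning
    I≡I' : I p ≡ I p'
    I≡I' = ++-replicate-cancel x x₀>0 (I p) (I p') (padding p) (padding p')
      (map-injective Y.injective (cong Partition.parts e)) (trans (x-sum p) (sym (x-sum p')))

↣⇒card-≤ : ∀ {A B : Set} {a b} → Fin b ↔ A → Fin a ↔ B → A ↣ B → b ≤ a
↣⇒card-≤ hb ha f = injective⇒≤ (Injection.injective ((↔⇒↣ (↔-sym ha) ↣-∘ f) ↣-∘ ↔⇒↣ hb))

lemma2p2 : (x y : ℕ → ℕ) (m : ℕ) →
    0 < x 0 → (∀ i → x i < x (suc i)) →
    0 < y 0 → (∀ i → y i < y (suc i)) →
    y 0 ≡ m → (∀ i → m ∣ y i) → (∀ i → x i ≥ y i) →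
    (n : ℕ) → n ≥ 1 →
    (a b : ℕ) → HasRho y (m * n) a → HasRho x (m * n) b → b ≤ a
lemma2p2 x y m x₀>0 x-inc _ y-inc y₀≡m m∣y x≥y n _ a b ρy ρx =
  ↣⇒card-≤ ρx ρy (mk↣ pad-injective)
  where open Padding x y m x₀>0 x-inc y-inc y₀≡m m∣y x≥y (m * n) (m∣m*n n)
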